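{- Let $\mu,\nu,\lambda$ be polynomial dominant weights of $GL_n$ and let $H\in\mathcal{H}(\mu,\nu,\lambda)$, with derived $t$-arrays $T_1(H)$ and $T_2(H)$. Then: (1) $H$ is a hive if and only if the dual array $(T_1(H))^*$ belongs to $GZ(\mu^*,\lambda^*-\nu^*,\nu^*)$; (2) $H$ is a hive if and only if $T_2(H)$ belongs to $GZ(\nu,\lambda-\mu,\mu)$.
   Context: A polynomial dominant weight of $GL_n$ is a sequence of nonnegative integers $\lambda=(\lambda_1,\dots,\lambda_n)$ with $\lambda_1\ge\dots\ge\lambda_n$; its dual is $\lambda^*=(-\lambda_n,-\lambda_{n-1},\dots,-\lambda_1)$. Differences such as $\lambda-\mu$ are componentwise. A $t$-array is an integer array $T=(t^{(i)}_j)_{1\le j\le i\le n}$; its $k$-th row is $(t^{(k)}_1,\dots,t^{(k)}_k)$, its type is its $n$-th row, and its weight is $(w_1,\dots,w_n)$ with $w_1=t^{(1)}_1$ and $w_i=\sum_{k=1}^i t^{(i)}_k-\sum_{k=1}^{i-1}t^{(i-1)}_k$ for $i\ge2$. Its dual array is $T^*=(s^{(i)}_j)$ with $s^{(i)}_j=-t^{(i)}_{i+1-j}$. $T$ is a GT pattern if $t^{(i+1)}_j\ge t^{(i)}_j$ (IC(1)) and $t^{(i)}_j\ge t^{(i+1)}_{j+1}$ (IC(2)) for all $1\le j\le i\le n-1$. The exponents of $T$ are $\varepsilon^{(i)}_j(T)=\sum_{1\le h<j}(t^{(i+1)}_h-2t^{(i)}_h+t^{(i-1)}_h)+(t^{(i+1)}_j-t^{(i)}_j)$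 for $1\le j\le i\le n-1$. For weakly decreasing $\alpha,\gamma\in\mathbb{Z}^n$ and $\beta\in\mathbb{Z}^n$, $GZ(\alpha,\beta,\gamma)$ is the set of GT patterns $T$ of type $\alpha$ and weight $\beta$ with $\varepsilon^{(i)}_j(T)\le\gamma_i-\gamma_{i+1}$ for all $1\le j\le i\le n-1$. An $h$-array is an array of nonnegative integers $H=(h_{a,b})_{0\le a\le b\le n}$ with $h_{0,0}=0$; $\mathcal{H}(\mu,\nu,\lambda)$ is the set of $h$-arrays with $h_{0,i}=\mu_1+\dots+\mu_i$, $h_{i,n}=\sum_{j=1}^n\mu_j+\nu_1+\dots+\nu_i$, $h_{i,i}=\lambda_1+\dots+\lambda_i$ for $1\le i\le n$. $H$ is a hive if RC(1): $h_{a,b}+h_{a-1,b-1}\ge h_{a-1,b}+h_{a,b-1}$ for $1\le a<b\le n$; RC(2): $h_{a-1,b}+h_{a,b}\ge h_{a,b+1}+h_{a-1,b-1}$ for $1\le a\le b<n$; RC(3): $h_{a,b}+h_{a,b+1}\ge h_{a+1,b+1}+h_{a-1,b}$ for $1\le a\le b<n$. The derived $t$-arrays $T_1(H)=(x^{(i)}_j)$, $T_2(H)=(y^{(i)}_j)$ are defined, for $0\le a\le b\le n-1$, by $x^{(n-a)}_{b+1-a}=h_{a,b+1}-h_{a,b}$ and $y^{(b+1)}_{a+1}=h_{a+1,b+1}-h_{a,b+1}$. -}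

module Defs where

open import Data.Nat as ℕ using (ℕ; zero; suc; _∸_)
open import Data.Integer as ℤ using (ℤ; +_; _-_; -_)
open import Data.Product using (_×_)
open import Relation.Binary.PropositionalEquality using (_≡_)

-- Conventions: all index families are functions on ℕ with the paper's
-- (1-based, resp. 0-based for h-arrays) indices; only the entries in the
-- paper's index range are ever inspected by the predicates below.

sumTo : (ℕ → ℤ) → ℕ → ℤ
sumTo f zero    = + 0
sumTo f (suc m) = sumTo f m ℤ.+ f (suc m)

-- a weight of GL_n : entries λ_1,…,λ_n (index i ↦ λ i, 1 ≤ i ≤ n)
-- polynomial dominant weight: nonnegative integers, weakly decreasing
PolyDominant : ℕ → (ℕ → ℕ) → Set
PolyDominant n λ' = ∀ i → 1 ℕ.≤ i → i ℕ.< n → λ' (suc i) ℕ.≤ λ' i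

toℤ : (ℕ → ℕ) → ℕ → ℤ
toℤ λ' i = + λ' i

dualW : ℕ → (ℕ → ℤ) → ℕ → ℤ
dualW n λ' i = - λ' (suc n ∸ i)

_−ʷ_ : (ℕ → ℤ) → (ℕ → ℤ) → ℕ → ℤ
(α −ʷ β) i = α i - β i

-- t-arrays:  T i j = t^{(i)}_j  for 1 ≤ j ≤ i ≤ n
TArray : Set
TArray = ℕ → ℕ → ℤ

-- weight of a t-array:  w_i = Σ_{k≤i} t^{(i)}_k − Σ_{k≤i-1} t^{(i-1)}_k
-- (for i = 1 the second sum is empty, so w_1 = t^{(1)}_1)
weightT : TArray → ℕ → ℤ
weightT T i = sumTo (T i) i - sumTo (T (i ∸ 1)) (i ∸ 1)

dualT : TArray → TArray
dualT T i j = - T i (suc i ∸ j)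

IsGT : ℕ → TArray → Set
IsGT n T = ∀ i j → 1 ℕ.≤ j → j ℕ.≤ i → i ℕ.≤ n ∸ 1 →
  (T i j ℤ.≤ T (suc i) j) × (T (suc i) (suc j) ℤ.≤ T i j)

exponent : TArray → ℕ → ℕ → ℤ
exponent T i j =
  sumTo (λ h → (T (suc i) h - (T i h ℤ.+ T i h)) ℤ.+ T (i ∸ 1) h) (j ∸ 1)
  ℤ.+ (T (suc i) j - T i j)

InGZ : ℕ → (α β γ : ℕ → ℤ) → TArray → Set
InGZ n α β γ T =
  IsGT n T
  × (∀ j → 1 ℕ.≤ j → j ℕ.≤ n → T n j ≡ α j)
  × (∀ i → 1 ℕ.≤ i → i ℕ.≤ n → weightT T i ≡ β i)
  × (∀ i j → 1 ℕ.≤ j → j ℕ.≤ i → i ℕ.≤ n ∸ 1 →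
       exponent T i j ℤ.≤ γ i - γ (suc i))

-- h-arrays: H a b = h_{a,b}, 0 ≤ a ≤ b ≤ n, nonnegative integers
HArray : Set
HArray = ℕ → ℕ → ℕ

psum : (ℕ → ℕ) → ℕ → ℕ
psum f zero    = 0
psum f (suc m) = psum f m ℕ.+ f (suc m)

InH : ℕ → (μ ν λ' : ℕ → ℕ) → HArray → Set
InH n μ ν λ' H =
  (H 0 0 ≡ 0)
  × (∀ i → 1 ℕ.≤ i → i ℕ.≤ n → H 0 i ≡ psum μ i)
  × (∀ i → 1 ℕ.≤ i → i ℕ.≤ n → H i n ≡ psum μ n ℕ.+ psum ν i)
  × (∀ i → 1 ℕ.≤ i → i ℕ.≤ n → H i i ≡ psum λ' i)

IsHive : ℕ → HArray → Set
IsHive n H =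
  (∀ a b → 1 ℕ.≤ a → a ℕ.< b → b ℕ.≤ n →
     H (a ∸ 1) b ℕ.+ H a (b ∸ 1) ℕ.≤ H a b ℕ.+ H (a ∸ 1) (b ∸ 1))
  × (∀ a b → 1 ℕ.≤ a → a ℕ.≤ b → b ℕ.< n →
     H a (suc b) ℕ.+ H (a ∸ 1) (b ∸ 1) ℕ.≤ H (a ∸ 1) b ℕ.+ H a b)
  × (∀ a b → 1 ℕ.≤ a → a ℕ.≤ b → b ℕ.< n →
     H (suc a) (suc b) ℕ.+ H (a ∸ 1) b ℕ.≤ H a b ℕ.+ H a (suc b))

-- derived t-arrays.
-- T₁: x^{(n-a)}_{b+1-a} = h_{a,b+1} - h_{a,b}  (0 ≤ a ≤ b ≤ n-1);
--   solved for (i , j) = (n-a , b+1-a):  a = n-i, b = n-i+j-1.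
T₁ : ℕ → HArray → TArray
T₁ n H i j = + H (n ∸ i) (n ∸ i ℕ.+ j) - + H (n ∸ i) (n ∸ i ℕ.+ j ∸ 1)

-- T₂: y^{(b+1)}_{a+1} = h_{a+1,b+1} - h_{a,b+1};
--   solved for (i , j) = (b+1 , a+1):  y^{(i)}_j = h_{j,i} - h_{j-1,i}.
T₂ : HArray → TArray
T₂ H i j = + H j i - + H (j ∸ 1) i

module Submission where

-- Both statements are instances of one fact about an arbitrary h-array G.
-- Let T agree, on the triangle 1 ≤ j ≤ i ≤ n, with the column differences
-- T₂ G, i.e. t^{(i)}_j = g_{j,i} − g_{j−1,i}.  Then the row sums of T
-- telescope to g_{m,k} − g_{0,k}, and every condition defining GZ(α,β,γ)
-- becomes a statement about G:
--   * IC(1) at (i,j) is RC(1) at (j,i+1), IC(2) at (i,j) is RC(3) at (j,i),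
--     and the exponent bound at (i,j) is RC(2) at (j,i), as soon as γ is the
--     sequence of increments of the top row g_{0,·};
--   * the type and weight of T are read off from the boundary of G.  Part (2) of the theorem is the case G = H.
-- For part (1) we use the reflection G(a,b) = H(n−b, n−a): it preserves the
-- hive conditions (RC(1) ↦ RC(1), RC(2) ↔ RC(3)), and its column differences
-- are exactly the dual array (T₁(H))*.

open import Defs
open import Data.Nat as ℕ using (ℕ; zero; suc; _∸_; s≤s; z≤n)
import Data.Nat.Properties as ℕP
open import Data.Integer as ℤ using (ℤ; +_; _+_; _-_; -_; 0ℤ)
import Data.Integer.Properties as ℤP
open import Data.Integer.Tactic.RingSolver using (solve-∀)
open import Data.Product using (_×_; _,_; proj₁; proj₂)
open import Function.Bundles using (_⇔_; mk⇔; Equivalence)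
import Function.Properties.Equivalence as ⇔
open import Relation.Binary.PropositionalEquality
open ≡-Reasoning

open Equivalence using (to; from)

rhombus⇔ : ∀ (A B C D : ℕ) {x y : ℤ} →
  y - x ≡ (+ C + + D) - (+ A + + B) → (A ℕ.+ B ℕ.≤ C ℕ.+ D ⇔ x ℤ.≤ y)
rhombus⇔ A B C D {x} {y} y-x = mk⇔
  (λ le → ℤP.0≤i-j⇒j≤i (subst (0ℤ ℤ.≤_) (sym y-x′) (ℤP.i≤j⇒0≤j-i (ℤ.+≤+ le))))
  (λ le → ℤP.drop‿+≤+ (ℤP.0≤i-j⇒j≤i (subst (0ℤ ℤ.≤_) y-x′ (ℤP.i≤j⇒0≤j-i le))))
  where
  y-x′ : y - x ≡ + (C ℕ.+ D) - + (A ℕ.+ B)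
  y-x′ = trans y-x (sym (cong₂ _-_ (ℤP.pos-+ C D) (ℤP.pos-+ A B)))

psum-step : ∀ c f m → + (c ℕ.+ psum f (suc m)) - + (c ℕ.+ psum f m) ≡ + f (suc m)
psum-step c f m = begin
  + (c ℕ.+ (s ℕ.+ v)) - + (c ℕ.+ s)    ≡⟨ cong₂ _-_ (trans (ℤP.pos-+ c _) (cong (λ t → + c + t) (ℤP.pos-+ s v)))
                                                    (ℤP.pos-+ c s) ⟩
  (+ c + (+ s + + v)) - (+ c + + s)     ≡⟨ cancel (+ c) (+ s) (+ v) ⟩
  + v                                   ∎
  where
  s = psum f m
  v = f (suc m)
  cancel : ∀ a b d → (a + (b + d)) - (a + b) ≡ d
  cancel = solve-∀

diff-swap : ∀ a b c d → (a - b) - (c - d) ≡ (a - c) - (b - d)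
diff-swap = solve-∀

negate-diff : ∀ x y → x - y ≡ - (y - x)
negate-diff = solve-∀

sumTo-cong : ∀ {f g : ℕ → ℤ} m → (∀ h → 1 ℕ.≤ h → h ℕ.≤ m → f h ≡ g h) →
  sumTo f m ≡ sumTo g m
sumTo-cong zero    _  = refl
sumTo-cong (suc m) eq = cong₂ _+_ (sumTo-cong m (λ h 1≤h h≤m → eq h 1≤h (ℕP.m≤n⇒m≤1+n h≤m)))
                                  (eq (suc m) (s≤s z≤n) ℕP.≤-refl)

sumTo-telescope : ∀ (g : ℕ → ℤ) m → sumTo (λ h → g h - g (h ∸ 1)) m ≡ g m - g 0
sumTo-telescope g zero    = sym (ℤP.+-inverseʳ (g 0))
sumTo-telescope g (suc m) = begin
  sumTo (λ h → g h - g (h ∸ 1)) m + (g (suc m) - g m) ≡⟨ cong (_+ (g (suc m) - g m)) (sumTo-telescope g m) ⟩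
  (g m - g 0) + (g (suc m) - g m)                       ≡⟨ ℤP.+-comm (g m - g 0) _ ⟩
  (g (suc m) - g m) + (g m - g 0)                       ≡⟨ ℤP.+-minus-telescope (g (suc m)) (g m) (g 0) ⟩
  g (suc m) - g 0                                       ∎

sumTo-secondDifference : ∀ (f g k : ℕ → ℤ) m →
  sumTo (λ h → (f h - (g h + g h)) + k h) m ≡ (sumTo f m - (sumTo g m + sumTo g m)) + sumTo k m
sumTo-secondDifference f g k zero    = refl
sumTo-secondDifference f g k (suc m) =
  trans (cong (_+ ((f (suc m) - (g (suc m) + g (suc m))) + k (suc m))) (sumTo-secondDifference f g k m))
        (regroup (sumTo f m) (sumTo g m) (sumTo k m) (f (suc m)) (g (suc m)) (k (suc m)))
  where
  regroup : ∀ a b c d e x →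
    ((a - (b + b)) + c) + ((d - (e + e)) + x) ≡ ((a + d) - ((b + e) + (b + e))) + (c + x)
  regroup = solve-∀

≤∸1⇒< : ∀ {n i} → 1 ℕ.≤ i → i ℕ.≤ n ∸ 1 → suc i ℕ.≤ n
≤∸1⇒< {zero}  (s≤s z≤n) ()
≤∸1⇒< {suc n} _         le = s≤s le

<⇒≤∸1 : ∀ {n i} → suc i ℕ.≤ n → i ℕ.≤ n ∸ 1
<⇒≤∸1 = ℕP.∸-monoˡ-≤ 1

∸-unfold : ∀ {n k} → suc k ℕ.≤ n → n ∸ k ≡ suc (n ∸ suc k)
∸-unfold = ℕP.+-∸-assoc 1

∸<self : ∀ {n k} → k ℕ.< n → n ∸ suc k ℕ.< n
∸<self {n} {k} k<n = ℕP.∸-monoʳ-< {n} {suc k} {0} (s≤s z≤n) k<n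

RC₁ RC₂ RC₃ : ℕ → HArray → Set
RC₁ n G = ∀ a b → 1 ℕ.≤ a → a ℕ.< b → b ℕ.≤ n →
  G (a ∸ 1) b ℕ.+ G a (b ∸ 1) ℕ.≤ G a b ℕ.+ G (a ∸ 1) (b ∸ 1)
RC₂ n G = ∀ a b → 1 ℕ.≤ a → a ℕ.≤ b → b ℕ.< n →
  G a (suc b) ℕ.+ G (a ∸ 1) (b ∸ 1) ℕ.≤ G (a ∸ 1) b ℕ.+ G a b
RC₃ n G = ∀ a b → 1 ℕ.≤ a → a ℕ.≤ b → b ℕ.< n →
  G (suc a) (suc b) ℕ.+ G (a ∸ 1) b ℕ.≤ G a b ℕ.+ G a (suc b)

ExponentBounds : ℕ → TArray → (ℕ → ℤ) → Set
ExponentBounds n T γ = ∀ i j → 1 ℕ.≤ j → j ℕ.≤ i → i ℕ.≤ n ∸ 1 → exponent T i j ℤ.≤ γ i - γ (suc i)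

module ColumnDifferences (n : ℕ) (G : HArray) (T : TArray)
  (agree : ∀ i j → 1 ℕ.≤ j → j ℕ.≤ i → i ℕ.≤ n → T i j ≡ T₂ G i j) where

  K : ℕ → ℕ → ℤ
  K a b = + G a b

  rowSum : ∀ k m → m ℕ.≤ k → k ℕ.≤ n → sumTo (T k) m ≡ K m k - K 0 k
  rowSum k m m≤k k≤n =
    trans (sumTo-cong m (λ h 1≤h h≤m → agree k h 1≤h (ℕP.≤-trans h≤m m≤k) k≤n))
          (sumTo-telescope (λ h → K h k) m)

  weight : ∀ i → i ℕ.≤ n → weightT T i ≡ (K i i - K 0 i) - (K (i ∸ 1) (i ∸ 1) - K 0 (i ∸ 1))
  weight i i≤n = cong₂ _-_ (rowSum i i ℕP.≤-refl i≤n)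
                           (rowSum (i ∸ 1) (i ∸ 1) ℕP.≤-refl (ℕP.≤-trans (ℕP.m∸n≤m i 1) i≤n))

  -- The exponent ε^{(i)}_j(T) is a rhombus of G minus a second difference of the top row.
  exponent-formula : ∀ i j → 1 ℕ.≤ j → j ℕ.≤ i → suc i ℕ.≤ n →
    exponent T i j ≡ ((K j (suc i) - K j i) - (K (j ∸ 1) i - K (j ∸ 1) (i ∸ 1)))
                     - ((K 0 (suc i) - K 0 i) - (K 0 i - K 0 (i ∸ 1)))
  exponent-formula i j 1≤j j≤i i<n = begin
    exponent T i j
      ≡⟨ cong (_+ (T (suc i) j - T i j)) (sumTo-secondDifference (T (suc i)) (T i) (T (i ∸ 1)) (j ∸ 1)) ⟩
    ((S (suc i) - (S i + S i)) + S (i ∸ 1)) + (T (suc i) j - T i j)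
      ≡⟨ cong₂ _+_ (cong₂ _+_ (cong₂ _-_ (rowSum (suc i) (j ∸ 1) j-1≤i+1 i<n)
                                         (cong₂ _+_ (rowSum i (j ∸ 1) j-1≤i i≤n) (rowSum i (j ∸ 1) j-1≤i i≤n)))
                              (rowSum (i ∸ 1) (j ∸ 1) j-1≤i-1 i-1≤n))
                   (cong₂ _-_ (agree (suc i) j 1≤j (ℕP.m≤n⇒m≤1+n j≤i) i<n) (agree i j 1≤j j≤i i≤n)) ⟩
    (((K (j ∸ 1) (suc i) - K 0 (suc i)) - ((K (j ∸ 1) i - K 0 i) + (K (j ∸ 1) i - K 0 i)))
      + (K (j ∸ 1) (i ∸ 1) - K 0 (i ∸ 1)))
      + ((K j (suc i) - K (j ∸ 1) (suc i)) - (K j i - K (j ∸ 1) i))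
      ≡⟨ regroup (K (j ∸ 1) (suc i)) (K 0 (suc i)) (K (j ∸ 1) i) (K 0 i)
                 (K (j ∸ 1) (i ∸ 1)) (K 0 (i ∸ 1)) (K j (suc i)) (K j i) ⟩
    ((K j (suc i) - K j i) - (K (j ∸ 1) i - K (j ∸ 1) (i ∸ 1)))
      - ((K 0 (suc i) - K 0 i) - (K 0 i - K 0 (i ∸ 1)))
      ∎
    where
    S : ℕ → ℤ
    S k = sumTo (T k) (j ∸ 1)
    i≤n = ℕP.<⇒≤ i<n
    j-1≤i = ℕP.≤-trans (ℕP.m∸n≤m j 1) j≤i
    j-1≤i+1 = ℕP.m≤n⇒m≤1+n j-1≤i
    j-1≤i-1 = ℕP.∸-monoˡ-≤ 1 j≤i
    i-1≤n = ℕP.≤-trans (ℕP.m∸n≤m i 1) i≤n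
    regroup : ∀ a b c d e f g h →
      (((a - b) - ((c - d) + (c - d))) + (e - f)) + ((g - a) - (h - c))
      ≡ ((g - h) - (c - e)) - ((b - d) - (d - f))
    regroup = solve-∀

  interlacing₁ : ∀ i j → 1 ℕ.≤ j → j ℕ.≤ i → suc i ℕ.≤ n →
    (G (j ∸ 1) (suc i) ℕ.+ G j i ℕ.≤ G j (suc i) ℕ.+ G (j ∸ 1) i) ⇔ (T i j ℤ.≤ T (suc i) j)
  interlacing₁ i j 1≤j j≤i i<n =
    rhombus⇔ (G (j ∸ 1) (suc i)) (G j i) (G j (suc i)) (G (j ∸ 1) i) (begin
    T (suc i) j - T i j
      ≡⟨ cong₂ _-_ (agree (suc i) j 1≤j (ℕP.m≤n⇒m≤1+n j≤i) i<n) (agree i j 1≤j j≤i (ℕP.<⇒≤ i<n)) ⟩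
    (K j (suc i) - K (j ∸ 1) (suc i)) - (K j i - K (j ∸ 1) i)
      ≡⟨ regroup (K j (suc i)) (K (j ∸ 1) (suc i)) (K j i) (K (j ∸ 1) i) ⟩
    (K j (suc i) + K (j ∸ 1) i) - (K (j ∸ 1) (suc i) + K j i)
      ∎)
    where
    regroup : ∀ a b c d → (a - b) - (c - d) ≡ (a + d) - (b + c)
    regroup = solve-∀

  interlacing₂ : ∀ i j → 1 ℕ.≤ j → j ℕ.≤ i → suc i ℕ.≤ n →
    (G (suc j) (suc i) ℕ.+ G (j ∸ 1) i ℕ.≤ G j i ℕ.+ G j (suc i)) ⇔ (T (suc i) (suc j) ℤ.≤ T i j)
  interlacing₂ i j 1≤j j≤i i<n =
    rhombus⇔ (G (suc j) (suc i)) (G (j ∸ 1) i) (G j i) (G j (suc i)) (begin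
    T i j - T (suc i) (suc j)
      ≡⟨ cong₂ _-_ (agree i j 1≤j j≤i (ℕP.<⇒≤ i<n)) (agree (suc i) (suc j) (s≤s z≤n) (s≤s j≤i) i<n) ⟩
    (K j i - K (j ∸ 1) i) - (K (suc j) (suc i) - K j (suc i))
      ≡⟨ regroup (K j i) (K (j ∸ 1) i) (K (suc j) (suc i)) (K j (suc i)) ⟩
    (K j i + K j (suc i)) - (K (suc j) (suc i) + K (j ∸ 1) i)
      ∎)
    where
    regroup : ∀ a b c d → (a - b) - (c - d) ≡ (a + d) - (c + b)
    regroup = solve-∀

  GT⇔RC₁×RC₃ : IsGT n T ⇔ (RC₁ n G × RC₃ n G)
  GT⇔RC₁×RC₃ = mk⇔
    (λ gt → rc₁ gt , rc₃ gt)
    (λ (rc₁ , rc₃) i j 1≤j j≤i i≤n-1 →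
       let i<n = ≤∸1⇒< (ℕP.≤-trans 1≤j j≤i) i≤n-1
       in to (interlacing₁ i j 1≤j j≤i i<n) (rc₁ j (suc i) 1≤j (s≤s j≤i) i<n)
        , to (interlacing₂ i j 1≤j j≤i i<n) (rc₃ j i 1≤j j≤i i<n))
    where
    rc₁ : IsGT n T → RC₁ n G
    rc₁ gt a (suc i) 1≤a (s≤s a≤i) i<n =
      from (interlacing₁ i a 1≤a a≤i i<n) (proj₁ (gt i a 1≤a a≤i (<⇒≤∸1 i<n)))
    rc₃ : IsGT n T → RC₃ n G
    rc₃ gt a b 1≤a a≤b b<n = from (interlacing₂ b a 1≤a a≤b b<n) (proj₂ (gt b a 1≤a a≤b (<⇒≤∸1 b<n)))

  module _ (γ : ℕ → ℤ) (γ-top : ∀ i → 1 ℕ.≤ i → i ℕ.≤ n → γ i ≡ K 0 i - K 0 (i ∸ 1)) where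

    exponentBound : ∀ i j → 1 ℕ.≤ j → j ℕ.≤ i → suc i ℕ.≤ n →
      (G j (suc i) ℕ.+ G (j ∸ 1) (i ∸ 1) ℕ.≤ G (j ∸ 1) i ℕ.+ G j i)
      ⇔ (exponent T i j ℤ.≤ γ i - γ (suc i))
    exponentBound i j 1≤j j≤i i<n =
      rhombus⇔ (G j (suc i)) (G (j ∸ 1) (i ∸ 1)) (G (j ∸ 1) i) (G j i) (begin
      (γ i - γ (suc i)) - exponent T i j
        ≡⟨ cong₂ _-_ (cong₂ _-_ (γ-top i 1≤i (ℕP.<⇒≤ i<n)) (γ-top (suc i) (s≤s z≤n) i<n))
                     (exponent-formula i j 1≤j j≤i i<n) ⟩
      ((K 0 i - K 0 (i ∸ 1)) - (K 0 (suc i) - K 0 i))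
        - (((K j (suc i) - K j i) - (K (j ∸ 1) i - K (j ∸ 1) (i ∸ 1)))
           - ((K 0 (suc i) - K 0 i) - (K 0 i - K 0 (i ∸ 1))))
        ≡⟨ regroup (K 0 (suc i)) (K 0 i) (K 0 (i ∸ 1)) (K j (suc i)) (K j i)
                   (K (j ∸ 1) i) (K (j ∸ 1) (i ∸ 1)) ⟩
      (K (j ∸ 1) i + K j i) - (K j (suc i) + K (j ∸ 1) (i ∸ 1))
        ∎)
      where
      1≤i = ℕP.≤-trans 1≤j j≤i
      regroup : ∀ p q r a b c d →
        ((q - r) - (p - q)) - (((a - b) - (c - d)) - ((p - q) - (q - r))) ≡ (c + b) - (a + d)
      regroup = solve-∀

    exponents⇔RC₂ : ExponentBounds n T γ ⇔ RC₂ n G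
    exponents⇔RC₂ = mk⇔
      (λ ex a b 1≤a a≤b b<n → from (exponentBound b a 1≤a a≤b b<n) (ex b a 1≤a a≤b (<⇒≤∸1 b<n)))
      (λ rc₂ i j 1≤j j≤i i≤n-1 →
         let i<n = ≤∸1⇒< (ℕP.≤-trans 1≤j j≤i) i≤n-1
         in to (exponentBound i j 1≤j j≤i i<n) (rc₂ j i 1≤j j≤i i<n))

    -- The main equivalence: the type and weight conditions hold outright,
    -- the remaining ones are the hive conditions.
    hive⇔GZ : ∀ (α β : ℕ → ℤ) →
      (∀ j → 1 ℕ.≤ j → j ℕ.≤ n → α j ≡ T₂ G n j) →
      (∀ i → 1 ℕ.≤ i → i ℕ.≤ n → β i ≡ (K i i - K 0 i) - (K (i ∸ 1) (i ∸ 1) - K 0 (i ∸ 1))) →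
      IsHive n G ⇔ InGZ n α β γ T
    hive⇔GZ α β α-bottom β-diagonal = mk⇔
      (λ (rc₁ , rc₂ , rc₃) → from GT⇔RC₁×RC₃ (rc₁ , rc₃) , type , weight-β , from exponents⇔RC₂ rc₂)
      (λ (gt , _ , _ , ex) → let (rc₁ , rc₃) = to GT⇔RC₁×RC₃ gt in rc₁ , to exponents⇔RC₂ ex , rc₃)
      where
      type : ∀ j → 1 ℕ.≤ j → j ℕ.≤ n → T n j ≡ α j
      type j 1≤j j≤n = trans (agree n j 1≤j j≤n ℕP.≤-refl) (sym (α-bottom j 1≤j j≤n))
      weight-β : ∀ i → 1 ℕ.≤ i → i ℕ.≤ n → weightT T i ≡ β i
      weight-β i 1≤i i≤n = trans (weight i i≤n) (sym (β-diagonal i 1≤i i≤n))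

Reflection : ℕ → HArray → HArray → Set
Reflection n G G′ = ∀ a b → a ℕ.≤ n → b ℕ.≤ n → G′ a b ≡ G (n ∸ b) (n ∸ a)

reflect : ℕ → HArray → HArray
reflect n G a b = G (n ∸ b) (n ∸ a)

reflection-sym : ∀ {n G G′} → Reflection n G G′ → Reflection n G′ G
reflection-sym {n} {G} {G′} R a b a≤n b≤n = sym (begin
  G′ (n ∸ b) (n ∸ a)               ≡⟨ R (n ∸ b) (n ∸ a) (ℕP.m∸n≤m n b) (ℕP.m∸n≤m n a) ⟩
  G (n ∸ (n ∸ a)) (n ∸ (n ∸ b))    ≡⟨ cong₂ G (ℕP.m∸[m∸n]≡n a≤n) (ℕP.m∸[m∸n]≡n b≤n) ⟩
  G a b                            ∎)

-- Reflection maps RC(1) to RC(1): the rhombus at (a, b) goes to the one at (n−b+1, n−a+1).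
reflect-RC₁ : ∀ {n G G′} → Reflection n G G′ → RC₁ n G → RC₁ n G′
reflect-RC₁ {n} {G} {G′} R rc₁ (suc a) (suc b) _ (s≤s a<b) b<n =
  reflected a b a<b b<n (ℕP.≤-trans a<b (ℕP.<⇒≤ b<n))
  where
  reflected : ∀ a b → a ℕ.< b → b ℕ.< n → a ℕ.< n →
    G′ a (suc b) ℕ.+ G′ (suc a) b ℕ.≤ G′ (suc a) (suc b) ℕ.+ G′ a b
  reflected a b a<b b<n a<n
    rewrite R a (suc b) (ℕP.<⇒≤ a<n) b<n | R (suc a) b a<n (ℕP.<⇒≤ b<n)
          | R (suc a) (suc b) a<n b<n | R a b (ℕP.<⇒≤ a<n) (ℕP.<⇒≤ b<n)
          | ∸-unfold a<n | ∸-unfold b<n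
    = ℕP.≤-trans (rc₁ (suc p) (suc q) (s≤s z≤n) (s≤s (ℕP.∸-monoʳ-< (s≤s a<b) b<n)) (∸<self a<n))
                 (ℕP.≤-reflexive (ℕP.+-comm (G (suc p) (suc q)) (G p q)))
    where
    p = n ∸ suc b
    q = n ∸ suc a

-- Reflection maps RC(3) to RC(2): the rhombus at (a, b) goes to the one at (n−b, n−a).
reflect-RC₂ : ∀ {n G G′} → Reflection n G G′ → RC₃ n G → RC₂ n G′
reflect-RC₂ {n} {G} {G′} R rc₃ (suc a) (suc b) _ (s≤s a≤b) b+1<n =
  reflected a b a≤b a<n b<n b+1<n
  where
  b<n = ℕP.<⇒≤ b+1<n
  a<n = ℕP.≤-trans (s≤s a≤b) b<n
  reflected : ∀ a b → a ℕ.≤ b → a ℕ.< n → b ℕ.< n → suc b ℕ.< n →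
    G′ (suc a) (suc (suc b)) ℕ.+ G′ a b ℕ.≤ G′ a (suc b) ℕ.+ G′ (suc a) (suc b)
  reflected a b a≤b a<n b<n b+1<n
    rewrite R (suc a) (suc (suc b)) a<n b+1<n | R a b (ℕP.<⇒≤ a<n) (ℕP.<⇒≤ b<n)
          | R a (suc b) (ℕP.<⇒≤ a<n) b<n | R (suc a) (suc b) a<n b<n
          | ∸-unfold a<n | ∸-unfold b<n | ∸-unfold b+1<n
    = ℕP.≤-trans (ℕP.≤-reflexive (ℕP.+-comm (G p q) (G (suc (suc p)) (suc q))))
        (ℕP.≤-trans (rc₃ (suc p) q (s≤s z≤n) (ℕP.∸-monoʳ-< (s≤s (s≤s a≤b)) b+1<n) (∸<self a<n))
                    (ℕP.≤-reflexive (ℕP.+-comm (G (suc p) q) (G (suc p) (suc q)))))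
    where
    p = n ∸ suc (suc b)
    q = n ∸ suc a

-- Reflection maps RC(2) to RC(3): the rhombus at (a, b) goes to the one at (n−b, n−a).
reflect-RC₃ : ∀ {n G G′} → Reflection n G G′ → RC₂ n G → RC₃ n G′
reflect-RC₃ {n} {G} {G′} R rc₂ (suc a) (suc b) _ (s≤s a≤b) b+1<n =
  reflected a b a≤b a<n a+1<n b+1<n
  where
  a+1<n = ℕP.≤-trans (s≤s (s≤s a≤b)) b+1<n
  a<n = ℕP.<⇒≤ a+1<n
  reflected : ∀ a b → a ℕ.≤ b → a ℕ.< n → suc a ℕ.< n → suc b ℕ.< n →
    G′ (suc (suc a)) (suc (suc b)) ℕ.+ G′ a (suc b) ℕ.≤ G′ (suc a) (suc b) ℕ.+ G′ (suc a) (suc (suc b))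
  reflected a b a≤b a<n a+1<n b+1<n
    rewrite R (suc (suc a)) (suc (suc b)) a+1<n b+1<n | R a (suc b) (ℕP.<⇒≤ a<n) (ℕP.<⇒≤ b+1<n)
          | R (suc a) (suc b) a<n (ℕP.<⇒≤ b+1<n) | R (suc a) (suc (suc b)) a<n b+1<n
          | ∸-unfold a<n | ∸-unfold a+1<n | ∸-unfold b+1<n
    = ℕP.≤-trans (ℕP.≤-reflexive (ℕP.+-comm (G p q) (G (suc p) (suc (suc q)))))
        (ℕP.≤-trans (rc₂ (suc p) (suc q) (s≤s z≤n) (s≤s (ℕP.∸-monoʳ-≤ n (s≤s (s≤s a≤b))))
                         (subst (ℕ._< n) (∸-unfold a+1<n) (∸<self a<n)))
                    (ℕP.≤-reflexive (ℕP.+-comm (G p (suc q)) (G (suc p) (suc q)))))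
    where
    p = n ∸ suc (suc b)
    q = n ∸ suc (suc a)

hive-reflect : ∀ {n G G′} → Reflection n G G′ → IsHive n G → IsHive n G′
hive-reflect {n} {G} {G′} R (rc₁ , rc₂ , rc₃) =
  reflect-RC₁ {n} {G} {G′} R rc₁ , reflect-RC₂ {n} {G} {G′} R rc₃ , reflect-RC₃ {n} {G} {G′} R rc₂

hive⇔reflected-hive : ∀ n H → IsHive n H ⇔ IsHive n (reflect n H)
hive⇔reflected-hive n H =
  mk⇔ (hive-reflect {n} {H} {reflect n H} reflection)
      (hive-reflect {n} {reflect n H} {H} (reflection-sym reflection))
  where
  reflection : Reflection n H (reflect n H)
  reflection _ _ _ _ = refl

complement-sum : ∀ {n i j} → j ℕ.≤ i → i ℕ.≤ n → (n ∸ i) ℕ.+ (i ∸ j) ≡ n ∸ j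
complement-sum {n} {i} {j} j≤i i≤n = begin
  (n ∸ i) ℕ.+ (i ∸ j)   ≡⟨ ℕP.+-∸-assoc (n ∸ i) j≤i ⟨
  (n ∸ i ℕ.+ i) ∸ j     ≡⟨ cong (_∸ j) (ℕP.m∸n+n≡m i≤n) ⟩
  n ∸ j                 ∎

dual-T₁ : ∀ n H i j → 1 ℕ.≤ j → j ℕ.≤ i → i ℕ.≤ n → dualT (T₁ n H) i j ≡ T₂ (reflect n H) i j
dual-T₁ n H i (suc j) _ j<i i≤n = begin
  - (+ H m (n ∸ i ℕ.+ (i ∸ j)) - + H m (n ∸ i ℕ.+ (i ∸ j) ∸ 1))
    ≡⟨ cong (λ k → - (+ H m k - + H m (k ∸ 1))) (trans (complement-sum (ℕP.<⇒≤ j<i) i≤n) (∸-unfold j<n)) ⟩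
  - (+ H m (suc r) - + H m r)
    ≡⟨ negate-diff (+ H m r) (+ H m (suc r)) ⟨
  + H m r - + H m (suc r)
    ≡⟨ cong (λ k → + H m r - + H m k) (∸-unfold j<n) ⟨
  + H m r - + H m (n ∸ j)
    ∎
  where
  j<n = ℕP.≤-trans j<i i≤n
  m = n ∸ i
  r = n ∸ suc j

module Boundary (n : ℕ) (μ ν λ' : ℕ → ℕ) (H : HArray) (inh : InH n μ ν λ' H) where

  private
    H₀₀ = proj₁ inh
    top = proj₁ (proj₂ inh)
    right = proj₁ (proj₂ (proj₂ inh))
    diagonal = proj₂ (proj₂ (proj₂ inh))

  H-top : ∀ k → k ℕ.≤ n → H 0 k ≡ psum μ k
  H-top zero    _   = H₀₀
  H-top (suc k) k<n = top (suc k) (s≤s z≤n) k<n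

  H-right : ∀ a → a ℕ.≤ n → H a n ≡ psum μ n ℕ.+ psum ν a
  H-right zero    _   = trans (H-top n ℕP.≤-refl) (sym (ℕP.+-identityʳ (psum μ n)))
  H-right (suc a) a<n = right (suc a) (s≤s z≤n) a<n

  H-diagonal : ∀ a → a ℕ.≤ n → H a a ≡ psum λ' a
  H-diagonal zero    _   = H₀₀
  H-diagonal (suc a) a<n = diagonal (suc a) (s≤s z≤n) a<n

  top-step : ∀ k → k ℕ.< n → + H 0 (suc k) - + H 0 k ≡ + μ (suc k)
  top-step k k<n =
    trans (cong₂ (λ x y → + x - + y) (H-top (suc k) k<n) (H-top k (ℕP.<⇒≤ k<n))) (psum-step 0 μ k)

  right-step : ∀ a → a ℕ.< n → + H (suc a) n - + H a n ≡ + ν (suc a)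
  right-step a a<n =
    trans (cong₂ (λ x y → + x - + y) (H-right (suc a) a<n) (H-right a (ℕP.<⇒≤ a<n))) (psum-step (psum μ n) ν a)

  diagonal-step : ∀ a → a ℕ.< n → + H (suc a) (suc a) - + H a a ≡ + λ' (suc a)
  diagonal-step a a<n =
    trans (cong₂ (λ x y → + x - + y) (H-diagonal (suc a) a<n) (H-diagonal a (ℕP.<⇒≤ a<n))) (psum-step 0 λ' a)

  γ-H : ∀ i → 1 ℕ.≤ i → i ℕ.≤ n → toℤ μ i ≡ + H 0 i - + H 0 (i ∸ 1)
  γ-H (suc i) _ i<n = sym (top-step i i<n)

  α-H : ∀ j → 1 ℕ.≤ j → j ℕ.≤ n → toℤ ν j ≡ T₂ H n j
  α-H (suc j) _ j<n = sym (right-step j j<n)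

  β-H : ∀ i → 1 ℕ.≤ i → i ℕ.≤ n →
    (toℤ λ' −ʷ toℤ μ) i ≡ (+ H i i - + H 0 i) - (+ H (i ∸ 1) (i ∸ 1) - + H 0 (i ∸ 1))
  β-H (suc i) _ i<n =
    sym (trans (diff-swap (+ H (suc i) (suc i)) (+ H 0 (suc i)) (+ H i i) (+ H 0 i))
               (cong₂ _-_ (diagonal-step i i<n) (top-step i i<n)))

  γ-reflect : ∀ i → 1 ℕ.≤ i → i ℕ.≤ n →
    dualW n (toℤ ν) i ≡ + reflect n H 0 i - + reflect n H 0 (i ∸ 1)
  γ-reflect (suc i) _ i<n rewrite ∸-unfold i<n =
    sym (trans (negate-diff (+ H r n) (+ H (suc r) n)) (cong -_ (right-step r (∸<self i<n))))
    where r = n ∸ suc i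

  α-reflect : ∀ j → 1 ℕ.≤ j → j ℕ.≤ n → dualW n (toℤ μ) j ≡ T₂ (reflect n H) n j
  α-reflect (suc j) _ j<n rewrite ℕP.n∸n≡0 n | ∸-unfold j<n =
    sym (trans (negate-diff (+ H 0 r) (+ H 0 (suc r))) (cong -_ (top-step r (∸<self j<n))))
    where r = n ∸ suc j

  β-reflect : ∀ i → 1 ℕ.≤ i → i ℕ.≤ n →
    (dualW n (toℤ λ') −ʷ dualW n (toℤ ν)) i
      ≡ (+ reflect n H i i - + reflect n H 0 i)
        - (+ reflect n H (i ∸ 1) (i ∸ 1) - + reflect n H 0 (i ∸ 1))
  β-reflect (suc i) _ i<n rewrite ∸-unfold i<n =
    sym (trans (diff-swap (+ H r r) (+ H r n) (+ H (suc r) (suc r)) (+ H (suc r) n))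
               (cong₂ _-_ (trans (negate-diff (+ H r r) (+ H (suc r) (suc r)))
                                 (cong -_ (diagonal-step r (∸<self i<n))))
                          (trans (negate-diff (+ H r n) (+ H (suc r) n))
                                 (cong -_ (right-step r (∸<self i<n))))))
    where r = n ∸ suc i

theorem3p2 : (n : ℕ) (μ ν λ' : ℕ → ℕ) →
    PolyDominant n μ → PolyDominant n ν → PolyDominant n λ' →
    (H : HArray) → InH n μ ν λ' H →
    (IsHive n H ⇔ InGZ n (dualW n (toℤ μ))
                         (dualW n (toℤ λ') −ʷ dualW n (toℤ ν))
                         (dualW n (toℤ ν)) (dualT (T₁ n H)))
    × (IsHive n H ⇔ InGZ n (toℤ ν) (toℤ λ' −ʷ toℤ μ) (toℤ μ) (T₂ H))
theorem3p2 n μ ν λ' _ _ _ H inh = part₁ , part₂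
  where
  open Boundary n μ ν λ' H inh
  part₁ : IsHive n H ⇔ InGZ n (dualW n (toℤ μ)) (dualW n (toℤ λ') −ʷ dualW n (toℤ ν))
                             (dualW n (toℤ ν)) (dualT (T₁ n H))
  part₁ = ⇔.trans (hive⇔reflected-hive n H)
                  (ColumnDifferences.hive⇔GZ n (reflect n H) (dualT (T₁ n H)) (dual-T₁ n H)
                     (dualW n (toℤ ν)) γ-reflect _ _ α-reflect β-reflect)
  part₂ : IsHive n H ⇔ InGZ n (toℤ ν) (toℤ λ' −ʷ toℤ μ) (toℤ μ) (T₂ H)
  part₂ = ColumnDifferences.hive⇔GZ n H (T₂ H) (λ _ _ _ _ _ → refl) (toℤ μ) γ-H _ _ α-H β-H
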